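{- Let $\mathcal{C}\subseteq\mathbb{F}_{q^m}^n$ be a non-degenerate $[n,k]_{q^m/q}$ code such that $\mathcal{C}^\perp$ is non-degenerate. Then there are $\mathbb{F}_{q^m}$-linear isomorphisms $\phi:\mathbb{F}_{q^m}^n/\mathcal{C}^\perp\to\mathbb{F}_{q^m}^k$ and $\psi:\mathbb{F}_{q^m}^n/\mathcal{C}\to\mathbb{F}_{q^m}^{n-k}$ with $\phi\big((\mathbb{F}_q^n+\mathcal{C}^\perp)/\mathcal{C}^\perp\big)=U_{\mathcal{C}}$ and $\psi\big((\mathbb{F}_q^n+\mathcal{C})/\mathcal{C}\big)=U_{\mathcal{C}^\perp}$. In particular, $U_{\mathcal{C}^\perp}$ is (up to such an isomorphism) a Delsarte dual of $U_{\mathcal{C}}$, namely the one obtained with $\mathbb{V}(n,q^m)=\mathbb{F}_{q^m}^n$, $W=\mathbb{F}_q^n$, $\Gamma=\mathcal{C}^\perp$ and $\sigma$ the standard bilinear form $\langle x,y\rangle=\sum_ix_iy_i$ (so $\Gamma^\perp=\mathcal{C}$).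
   Context: $q$ a prime power, $m,n,k$ positive integers. An $[n,k]_{q^m/q}$ (rank-metric) code is a $k$-dimensional $\mathbb{F}_{q^m}$-subspace $\mathcal{C}$ of $\mathbb{F}_{q^m}^n$ (endowed with the rank metric, the rank weight of $v$ being $\dim_{\mathbb{F}_q}\langle v_1,\dots,v_n\rangle_{\mathbb{F}_q}$); $\mathcal{C}^\perp$ is its dual with respect to the standard bilinear form $\langle x,y\rangle=\sum_i x_iy_i$. A code is non-degenerate if the columns of a generator matrix are $\mathbb{F}_q$-linearly independent. For a non-degenerate code with generator matrix $G\in\mathbb{F}_{q^m}^{k\times n}$, an associated system $U_{\mathcal{C}}$ is the $\mathbb{F}_q$-span of the columns of $G$ in $\mathbb{F}_{q^m}^k$ (defined up to $\mathrm{GL}(k,q^m)$). Delsarte dual: given an $n$-dimensional $\mathbb{F}_{q^m}$-space with an $n$-dim $\mathbb{F}_q$-subspace $W$ spanning it over $\mathbb{F}_{q^m}$, an $\mathbb{F}_{q^m}$-bilinear non-degenerate reflexive form $\sigma$ extending one on $W$, and an $\mathbb{F}_{q^m}$-subspace $\Gamma$ with $\Gamma\cap W=\{0\}$, the subspace $(W+\Gamma^\perp)/\Gamma^\perp$ is called a Delsarte dual of $(W+\Gamma)/\Gamma$. -}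

module Defs where

open import Level using (0ℓ)
open import Data.Nat using (ℕ; zero; suc; _≤_; _^_)
open import Data.Nat.Primality using (Prime)
open import Data.Fin using (Fin)
import Data.Fin as F
open import Data.Product using (Σ; ∃; ∃-syntax; _×_; _,_)
open import Data.Unit using (⊤)
open import Relation.Nullary using (¬_)
open import Relation.Binary.PropositionalEquality using (_≡_)
open import Function.Bundles using (_⇔_)
import Algebra.Structures as S

IsPrimePower : ℕ → Set
IsPrimePower q = ∃[ p ] ∃[ e ] (Prime p × 1 ≤ e × q ≡ p ^ e)

record Field : Set₁ where
  infixl 6 _+_
  infixl 7 _*_
  field
    Carrier : Set
    _+_ _*_ : Carrier → Carrier → Carrier
    -_ : Carrier → Carrier
    0# 1# : Carrier
    isCommutativeRing : S.IsCommutativeRing (_≡_ {A = Carrier}) _+_ _*_ -_ 0# 1#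
    0≢1 : ¬ (0# ≡ 1#)
    inverse : ∀ x → ¬ (x ≡ 0#) → ∃[ y ] (x * y ≡ 1#)

module _ (L : Field) where
  open Field L

  sumF : ∀ {r} → (Fin r → Carrier) → Carrier
  sumF {zero} f = 0#
  sumF {suc r} f = f F.zero + sumF (λ i → f (F.suc i))

  _≋_ : ∀ {d} → (Fin d → Carrier) → (Fin d → Carrier) → Set
  x ≋ y = ∀ j → x j ≡ y j

  zeroV : ∀ {d} → Fin d → Carrier
  zeroV _ = 0#

  _+V_ : ∀ {d} → (Fin d → Carrier) → (Fin d → Carrier) → Fin d → Carrier
  (x +V y) j = x j + y j

  _·V_ : ∀ {d} → Carrier → (Fin d → Carrier) → Fin d → Carrier
  (a ·V x) j = a * x j

  lc : ∀ {r d} → (Fin r → Carrier) → (Fin r → Fin d → Carrier) → Fin d → Carrier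
  lc a v j = sumF (λ i → a i * v i j)

  IndepOver : (Carrier → Set) → ∀ {r d} → (Fin r → Fin d → Carrier) → Set
  IndepOver P v = ∀ a → (∀ i → P (a i)) → lc a v ≋ zeroV → ∀ i → a i ≡ 0#

  SpanOver : (Carrier → Set) → ∀ {r d} → (Fin r → Fin d → Carrier) → (Fin d → Carrier) → Set
  SpanOver P v x = ∃[ a ] ((∀ i → P (a i)) × x ≋ lc a v)

  AllL : Carrier → Set
  AllL _ = ⊤

  dot : ∀ {n} → (Fin n → Carrier) → (Fin n → Carrier) → Carrier
  dot x y = sumF (λ i → x i * y i)

  cols : ∀ {k n} → (Fin k → Fin n → Carrier) → Fin n → Fin k → Carrier
  cols G j i = G i j

  Code : ∀ {k n} → (Fin k → Fin n → Carrier) → (Fin n → Carrier) → Set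
  Code G = SpanOver AllL G

  Dual : ∀ {n} → ((Fin n → Carrier) → Set) → (Fin n → Carrier) → Set
  Dual C y = ∀ c → C c → dot c y ≡ 0#

  IsGeneratorMatrix : ∀ {r n} → (Fin r → Fin n → Carrier) → ((Fin n → Carrier) → Set) → Set
  IsGeneratorMatrix H Sp = IndepOver AllL H × (∀ x → Sp x ⇔ SpanOver AllL H x)

  IsLinear : ∀ {n d} → ((Fin n → Carrier) → (Fin d → Carrier)) → Set
  IsLinear f = (∀ x y → x ≋ y → f x ≋ f y)
             × (∀ x y → f (x +V y) ≋ (f x +V f y))
             × (∀ a x → f (a ·V x) ≋ (a ·V f x))

  -- An L-linear isomorphism L^n / Sp → L^d, presented by the linear map
  -- f : L^n → L^d it is induced by: f is L-linear, surjective, with kernel exactly Sp.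
  IsQuotientIso : ∀ {n d} → ((Fin n → Carrier) → Set) → ((Fin n → Carrier) → (Fin d → Carrier)) → Set
  IsQuotientIso Sp f = IsLinear f
                     × (∀ y → ∃[ x ] (f x ≋ y))
                     × (∀ x → (f x ≋ zeroV) ⇔ Sp x)

  -- the image under (the map induced by) f of (W + Sp)/Sp, W = vectors with entries in K,
  -- equals the subset U
  ImageEq : ∀ {n d} → (Carrier → Set) → ((Fin n → Carrier) → Set)
          → ((Fin n → Carrier) → (Fin d → Carrier)) → ((Fin d → Carrier) → Set) → Set
  ImageEq K Sp f U = ∀ y → U y ⇔ (∃[ w ] ∃[ c ] ((∀ i → K (w i)) × Sp c × f (w +V c) ≋ y))

  record IsSubfield (K : Carrier → Set) : Set where
    field
      0∈ : K 0#
      1∈ : K 1#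
      +∈ : ∀ {x y} → K x → K y → K (x + y)
      *∈ : ∀ {x y} → K x → K y → K (x * y)
      -∈ : ∀ {x} → K x → K (- x)
      inv∈ : ∀ {x y} → K x → x * y ≡ 1# → K y

  ImageOf : ∀ {q} → (Fin q → Carrier) → Carrier → Set
  ImageOf e x = ∃[ i ] (e i ≡ x)

  -- L is an extension of degree m of the subfield K: it has a K-basis of size m
  HasDegree : (Carrier → Set) → ℕ → Set
  HasDegree K m = Σ (Fin m → Fin 1 → Carrier) λ b →
    IndepOver K b × (∀ x → SpanOver K b (λ _ → x))

-- φ and ψ are x ↦ Gx and x ↦ Hx.  The kernel of x ↦ Gx is C⊥, and that of x ↦ Hx is
-- C⊥⊥ = C; both maps are onto because the rows of G, resp. H, are independent; and w + c
-- with w ∈ 𝔽_q^n and c in the kernel is sent to the 𝔽_q-combination of the columns with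
-- coefficients w.  Constructively, surjectivity and C⊥⊥ ⊆ C both rest on the Fredholm
-- alternative (either Ax = y is solvable or some z has zᵀA = 0 and z·y ≠ 0), proved by
-- Gaussian elimination.  Elimination must decide x = 0 in 𝔽_{q^m}; this is possible because
-- x = 0 iff all its coordinates in an 𝔽_q-basis vanish, and 𝔽_q is finite.

{-# OPTIONS --safe #-}
module Submission where

open import Defs
open import Data.Nat using (ℕ; _≤_; _∸_; zero; suc)
open import Data.Fin using (Fin; zero; suc; _≟_)
open import Data.Fin.Properties using (all?; ¬∀⟶∃¬)
open import Data.Vec.Functional using (Vector; _∷_; tail)
open import Data.Product using (∃-syntax; _×_; _,_; proj₁; proj₂)
open import Data.Sum using (_⊎_; inj₁; inj₂)
import Data.Sum as Sum
open import Data.Unit using (tt)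
open import Relation.Nullary using (Dec; yes; no; ¬_; contradiction)
open import Relation.Binary.PropositionalEquality
  using (_≡_; _≗_; refl; sym; trans; cong; cong₂; module ≡-Reasoning)
open import Function.Bundles using (_⇔_; mk⇔; Equivalence)
open import Algebra.Bundles using (CommutativeRing)
import Algebra.Properties.CommutativeSemigroup as CommutativeSemigroupProperties
import Algebra.Properties.Ring as RingProperties
import Algebra.Properties.Semiring.Sum as SumProperties

module LinearAlgebra (L : Field) where

  commutativeRing : CommutativeRing _ _
  commutativeRing = record { isCommutativeRing = Field.isCommutativeRing L }

  open Field L using (Carrier; inverse)
  open CommutativeRing commutativeRing hiding (Carrier; refl; sym; trans; zero)
  open CommutativeSemigroupProperties *-commutativeSemigroup
    using () renaming (x∙yz≈y∙xz to x*[y*z]≡y*[x*z])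
  open RingProperties ring using (+-cancelʳ; -‿distribˡ-*; xyx⁻¹≈y)
  open SumProperties semiring
    using (sum; sum-cong-≗; sum-replicate-zero; ∑-distrib-+; ∑-comm; *-distribˡ-sum; *-distribʳ-sum)
  open ≡-Reasoning

  infixl 6 _+ᵛ_
  infixr 7 _·ᵛ_
  infixl 7 _∙_
  infixr 8 _*ᴹ_

  0ᵛ : ∀ {n} → Vector Carrier n
  0ᵛ = zeroV L

  _+ᵛ_ : ∀ {n} → Vector Carrier n → Vector Carrier n → Vector Carrier n
  _+ᵛ_ = _+V_ L

  _·ᵛ_ : ∀ {n} → Carrier → Vector Carrier n → Vector Carrier n
  _·ᵛ_ = _·V_ L

  _∙_ : ∀ {n} → Vector Carrier n → Vector Carrier n → Carrier
  _∙_ = dot L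

  _*ᴹ_ : ∀ {r n} → (Fin r → Fin n → Carrier) → Vector Carrier n → Vector Carrier r
  (A *ᴹ x) i = A i ∙ x

  sumF≡sum : ∀ {r} (f : Vector Carrier r) → sumF L f ≡ sum f
  sumF≡sum {zero}  f = refl
  sumF≡sum {suc r} f = cong (f zero +_) (sumF≡sum (tail f))

  sumF-cong : ∀ {r} {f g : Vector Carrier r} → f ≗ g → sumF L f ≡ sumF L g
  sumF-cong {f = f} {g} f≗g rewrite sumF≡sum f | sumF≡sum g = sum-cong-≗ f≗g

  sumF-zero : ∀ {r} {f : Vector Carrier r} → f ≗ 0ᵛ → sumF L f ≡ 0#
  sumF-zero {r} f≗0 = trans (sumF-cong f≗0) (trans (sumF≡sum (0ᵛ {r})) (sum-replicate-zero r))

  sumF-distrib-+ : ∀ {r} (f g : Vector Carrier r) → sumF L (λ i → f i + g i) ≡ sumF L f + sumF L g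
  sumF-distrib-+ f g
    rewrite sumF≡sum (λ i → f i + g i) | sumF≡sum f | sumF≡sum g = ∑-distrib-+ f g

  *-distribˡ-sumF : ∀ {r} c (f : Vector Carrier r) → c * sumF L f ≡ sumF L (λ i → c * f i)
  *-distribˡ-sumF c f rewrite sumF≡sum f | sumF≡sum (λ i → c * f i) = *-distribˡ-sum c f

  *-distribʳ-sumF : ∀ {r} c (f : Vector Carrier r) → sumF L f * c ≡ sumF L (λ i → f i * c)
  *-distribʳ-sumF c f rewrite sumF≡sum f | sumF≡sum (λ i → f i * c) = *-distribʳ-sum c f

  sumF-comm : ∀ {r s} (f : Fin r → Fin s → Carrier) →
    sumF L (λ i → sumF L (f i)) ≡ sumF L (λ j → sumF L (λ i → f i j))
  sumF-comm f = begin
    sumF L (λ i → sumF L (f i))         ≡⟨ sumF-cong (λ i → sumF≡sum (f i)) ⟩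
    sumF L (λ i → sum (f i))            ≡⟨ sumF≡sum (λ i → sum (f i)) ⟩
    sum (λ i → sum (f i))               ≡⟨ ∑-comm f ⟩
    sum (λ j → sum (λ i → f i j))       ≡⟨ sumF≡sum (λ j → sum (λ i → f i j)) ⟨
    sumF L (λ j → sum (λ i → f i j))    ≡⟨ sumF-cong (λ j → sumF≡sum (λ i → f i j)) ⟨
    sumF L (λ j → sumF L (λ i → f i j)) ∎

  ∙-comm : ∀ {n} (x y : Vector Carrier n) → x ∙ y ≡ y ∙ x
  ∙-comm x y = sumF-cong (λ i → *-comm (x i) (y i))

  ∙-congˡ : ∀ {n} {x x′ : Vector Carrier n} (y : Vector Carrier n) → x ≗ x′ → x ∙ y ≡ x′ ∙ y
  ∙-congˡ y x≗x′ = sumF-cong (λ i → cong (_* y i) (x≗x′ i))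

  ∙-congʳ : ∀ {n} (x : Vector Carrier n) {y y′ : Vector Carrier n} → y ≗ y′ → x ∙ y ≡ x ∙ y′
  ∙-congʳ x y≗y′ = sumF-cong (λ i → cong (x i *_) (y≗y′ i))

  ∙-zeroˡ : ∀ {n} {x : Vector Carrier n} (y : Vector Carrier n) → x ≗ 0ᵛ → x ∙ y ≡ 0#
  ∙-zeroˡ y x≗0 = sumF-zero (λ i → trans (cong (_* y i) (x≗0 i)) (zeroˡ (y i)))

  ∙-zeroʳ : ∀ {n} (x : Vector Carrier n) {y : Vector Carrier n} → y ≗ 0ᵛ → x ∙ y ≡ 0#
  ∙-zeroʳ x {y} y≗0 = trans (∙-comm x y) (∙-zeroˡ x y≗0)

  ∙-distribˡ-+ : ∀ {n} (x y z : Vector Carrier n) → x ∙ (y +ᵛ z) ≡ x ∙ y + x ∙ z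
  ∙-distribˡ-+ x y z = trans (sumF-cong (λ i → distribˡ (x i) (y i) (z i)))
                             (sumF-distrib-+ (λ i → x i * y i) (λ i → x i * z i))

  ∙-*ʳ : ∀ {n} (x : Vector Carrier n) c y → x ∙ (c ·ᵛ y) ≡ c * (x ∙ y)
  ∙-*ʳ x c y = trans (sumF-cong (λ i → x*[y*z]≡y*[x*z] (x i) c (y i)))
                     (sym (*-distribˡ-sumF c (λ i → x i * y i)))

  ∙-lc : ∀ {r n} (a : Vector Carrier r) (A : Fin r → Fin n → Carrier) x →
    lc L a A ∙ x ≡ a ∙ (A *ᴹ x)
  ∙-lc a A x = begin
    sumF L (λ j → sumF L (λ i → a i * A i j) * x j)
      ≡⟨ sumF-cong (λ j → *-distribʳ-sumF (x j) (λ i → a i * A i j)) ⟩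
    sumF L (λ j → sumF L (λ i → a i * A i j * x j))
      ≡⟨ sumF-comm (λ i j → a i * A i j * x j) ⟨
    sumF L (λ i → sumF L (λ j → a i * A i j * x j))
      ≡⟨ sumF-cong (λ i → sumF-cong (λ j → *-assoc (a i) (A i j) (x j))) ⟩
    sumF L (λ i → sumF L (λ j → a i * (A i j * x j)))
      ≡⟨ sumF-cong (λ i → *-distribˡ-sumF (a i) (λ j → A i j * x j)) ⟨
    a ∙ (A *ᴹ x)
      ∎

  unit : ∀ {n} → Fin n → Vector Carrier n
  unit zero    = 1# ∷ 0ᵛ
  unit (suc p) = 0# ∷ unit p

  ∙-unitʳ : ∀ {n} (x : Vector Carrier n) p → x ∙ unit p ≡ x p
  ∙-unitʳ x zero = begin
    x zero * 1# + tail x ∙ 0ᵛ ≡⟨ cong₂ _+_ (*-identityʳ (x zero)) (∙-zeroʳ (tail x) (λ _ → refl)) ⟩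
    x zero + 0#               ≡⟨ +-identityʳ (x zero) ⟩
    x zero                    ∎
  ∙-unitʳ x (suc p) = begin
    x zero * 0# + tail x ∙ unit p ≡⟨ cong₂ _+_ (zeroʳ (x zero)) (∙-unitʳ (tail x) p) ⟩
    0# + x (suc p)                ≡⟨ +-identityˡ (x (suc p)) ⟩
    x (suc p)                     ∎

  ∙-unitˡ : ∀ {n} p (x : Vector Carrier n) → unit p ∙ x ≡ x p
  ∙-unitˡ p x = trans (∙-comm (unit p) x) (∙-unitʳ x p)

  ∙-shift-unit : ∀ {n} (v x : Vector Carrier n) t p → v ∙ (x +ᵛ t ·ᵛ unit p) ≡ v ∙ x + t * v p
  ∙-shift-unit v x t p = begin
    v ∙ (x +ᵛ t ·ᵛ unit p)    ≡⟨ ∙-distribˡ-+ v x (t ·ᵛ unit p) ⟩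
    v ∙ x + v ∙ (t ·ᵛ unit p) ≡⟨ cong (v ∙ x +_) (∙-*ʳ v t (unit p)) ⟩
    v ∙ x + t * (v ∙ unit p)  ≡⟨ cong (λ s → v ∙ x + t * s) (∙-unitʳ v p) ⟩
    v ∙ x + t * v p           ∎

  *ᴹ-isLinear : ∀ {r n} (A : Fin r → Fin n → Carrier) → IsLinear L (A *ᴹ_)
  *ᴹ-isLinear A =
      (λ x y x≗y i → ∙-congʳ (A i) x≗y)
    , (λ x y i → ∙-distribˡ-+ (A i) x y)
    , (λ c x i → ∙-*ʳ (A i) c x)

  row∈span : ∀ {r n} (A : Fin r → Fin n → Carrier) i → SpanOver L (AllL L) A (A i)
  row∈span A i = unit i , (λ _ → tt) , λ j → sym (∙-unitˡ i (cols L A j))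

  span-orthogonal : ∀ {r n} {K : Carrier → Set} (A : Fin r → Fin n → Carrier) {x c} →
    A *ᴹ x ≗ 0ᵛ → SpanOver L K A c → c ∙ x ≡ 0#
  span-orthogonal A {x} {c} Ax≗0 (a , _ , c≗aA) = begin
    c ∙ x        ≡⟨ ∙-congˡ x c≗aA ⟩
    lc L a A ∙ x ≡⟨ ∙-lc a A x ⟩
    a ∙ (A *ᴹ x) ≡⟨ ∙-zeroʳ a Ax≗0 ⟩
    0#           ∎

  *ᴹ≗0⇔dual : ∀ {r n} (G : Fin r → Fin n → Carrier) x → (G *ᴹ x ≗ 0ᵛ) ⇔ Dual L (Code L G) x
  *ᴹ≗0⇔dual G x = mk⇔
    (λ Gx≗0 c c∈C → span-orthogonal G Gx≗0 c∈C)
    (λ x∈C⊥ i → x∈C⊥ (G i) (row∈span G i))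

  imageEq-*ᴹ : ∀ {r n} (K : Carrier → Set) {S : Vector Carrier n → Set} (M : Fin r → Fin n → Carrier) →
    (∀ x → (M *ᴹ x ≗ 0ᵛ) ⇔ S x) → ImageEq L K S (M *ᴹ_) (SpanOver L K (cols L M))
  imageEq-*ᴹ K {S} M ker y = mk⇔ to from
    where
    Preimage : Set
    Preimage = ∃[ w ] ∃[ c ] ((∀ i → K (w i)) × S c × M *ᴹ (w +ᵛ c) ≗ y)

    to : SpanOver L K (cols L M) y → Preimage
    to (w , w∈K , y≗Mw) = w , 0ᵛ , w∈K , 0∈S , λ i → begin
      M i ∙ (w +ᵛ 0ᵛ) ≡⟨ ∙-congʳ (M i) (λ j → +-identityʳ (w j)) ⟩
      M i ∙ w         ≡⟨ ∙-comm (M i) w ⟩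
      w ∙ M i         ≡⟨ y≗Mw i ⟨
      y i             ∎
      where
      0∈S : S 0ᵛ
      0∈S = Equivalence.to (ker 0ᵛ) (λ i → ∙-zeroʳ (M i) (λ _ → refl))

    from : Preimage → SpanOver L K (cols L M) y
    from (w , c , w∈K , c∈S , M[w+c]≗y) = w , w∈K , λ i → begin
      y i               ≡⟨ M[w+c]≗y i ⟨
      M i ∙ (w +ᵛ c)    ≡⟨ ∙-distribˡ-+ (M i) w c ⟩
      M i ∙ w + M i ∙ c ≡⟨ cong (M i ∙ w +_) (Equivalence.from (ker c) c∈S i) ⟩
      M i ∙ w + 0#      ≡⟨ +-identityʳ (M i ∙ w) ⟩
      M i ∙ w           ≡⟨ ∙-comm (M i) w ⟩
      w ∙ M i           ∎

  Solvable : ∀ {r n} → (Fin r → Fin n → Carrier) → Vector Carrier r → Set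
  Solvable A y = ∃[ x ] (A *ᴹ x ≗ y)

  Obstructed : ∀ {r n} → (Fin r → Fin n → Carrier) → Vector Carrier r → Set
  Obstructed A y = ∃[ z ] (lc L z A ≗ 0ᵛ × ¬ (z ∙ y ≡ 0#))

  shear : ∀ {r} → Vector Carrier r → Vector Carrier (suc r) → Vector Carrier r
  shear d v i = v (suc i) + d i * v zero

  shearᴹ : ∀ {r n} → Vector Carrier r → (Fin (suc r) → Fin n → Carrier) → Fin r → Fin n → Carrier
  shearᴹ d A i j = shear d (cols L A j) i

  ∙-shear : ∀ {r} (z d : Vector Carrier r) v → z ∙ shear d v ≡ (z ∙ d ∷ z) ∙ v
  ∙-shear z d v = begin
    z ∙ shear d v                  ≡⟨ ∙-congʳ z (λ i → cong (v (suc i) +_) (*-comm (d i) (v zero))) ⟩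
    z ∙ (tail v +ᵛ v zero ·ᵛ d)    ≡⟨ ∙-distribˡ-+ z (tail v) (v zero ·ᵛ d) ⟩
    z ∙ tail v + z ∙ (v zero ·ᵛ d) ≡⟨ cong (z ∙ tail v +_) (∙-*ʳ z (v zero) d) ⟩
    z ∙ tail v + v zero * (z ∙ d)  ≡⟨ +-comm (z ∙ tail v) (v zero * (z ∙ d)) ⟩
    v zero * (z ∙ d) + z ∙ tail v  ≡⟨ cong (_+ z ∙ tail v) (*-comm (v zero) (z ∙ d)) ⟩
    (z ∙ d ∷ z) ∙ v                ∎

  shearᴹ-*ᴹ : ∀ {r n} d (A : Fin (suc r) → Fin n → Carrier) x → shearᴹ d A *ᴹ x ≗ shear d (A *ᴹ x)
  shearᴹ-*ᴹ d A x i = begin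
    shearᴹ d A i ∙ x                    ≡⟨ ∙-comm (shearᴹ d A i) x ⟩
    x ∙ (A (suc i) +ᵛ d i ·ᵛ A zero)    ≡⟨ ∙-distribˡ-+ x (A (suc i)) (d i ·ᵛ A zero) ⟩
    x ∙ A (suc i) + x ∙ (d i ·ᵛ A zero) ≡⟨ cong₂ _+_ (∙-comm x (A (suc i))) (∙-*ʳ x (d i) (A zero)) ⟩
    A (suc i) ∙ x + d i * (x ∙ A zero)  ≡⟨ cong (λ s → A (suc i) ∙ x + d i * s) (∙-comm x (A zero)) ⟩
    shear d (A *ᴹ x) i                  ∎

  shear-cancel : ∀ {r} (d : Vector Carrier r) {u v} → shear d u ≗ shear d v → u zero ≡ v zero → u ≗ v
  shear-cancel d du≗dv u₀≡v₀ zero = u₀≡v₀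
  shear-cancel d {u} {v} du≗dv u₀≡v₀ (suc i) = +-cancelʳ (d i * v zero) (u (suc i)) (v (suc i))
    (trans (cong (λ s → u (suc i) + d i * s) (sym u₀≡v₀)) (du≗dv i))

  solvable-unshear : ∀ {r n} d (A : Fin (suc r) → Fin n → Carrier) y x →
    shearᴹ d A *ᴹ x ≗ shear d y → A zero ∙ x ≡ y zero → A *ᴹ x ≗ y
  solvable-unshear d A y x x-solves row₀ =
    shear-cancel d (λ i → trans (sym (shearᴹ-*ᴹ d A x i)) (x-solves i)) row₀

  obstructed-unshear : ∀ {r n} d (A : Fin (suc r) → Fin n → Carrier) y →
    Obstructed (shearᴹ d A) (shear d y) → Obstructed A y
  obstructed-unshear d A y (z , zA′≗0 , zy′≢0) =
      z ∙ d ∷ z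
    , (λ j → trans (sym (∙-shear z d (cols L A j))) (zA′≗0 j))
    , (λ zy≡0 → zy′≢0 (trans (∙-shear z d y) zy≡0))

  obstructed-by-zero-row : ∀ {r n} (A : Fin (suc r) → Fin n → Carrier) y →
    A zero ≗ 0ᵛ → ¬ (y zero ≡ 0#) → Obstructed A y
  obstructed-by-zero-row A y a≗0 y₀≢0 =
      unit zero
    , (λ j → trans (∙-unitˡ zero (cols L A j)) (a≗0 j))
    , (λ y₀≡0 → y₀≢0 (trans (sym (∙-unitˡ zero y)) y₀≡0))

  solvable-unshear-zero-row : ∀ {r n} d (A : Fin (suc r) → Fin n → Carrier) y →
    A zero ≗ 0ᵛ → y zero ≡ 0# → Solvable (shearᴹ d A) (shear d y) → Solvable A y
  solvable-unshear-zero-row d A y a≗0 y₀≡0 (x , x-solves) =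
    x , solvable-unshear d A y x x-solves (trans (∙-zeroˡ x a≗0) (sym y₀≡0))

  pivotMultipliers : ∀ {r n} → (Fin (suc r) → Fin n → Carrier) → Fin n → Carrier → Vector Carrier r
  pivotMultipliers A p ι i = - (A (suc i) p * ι)

  shearᴹ-clears-pivot : ∀ {r n} (A : Fin (suc r) → Fin n → Carrier) {p ι} → A zero p * ι ≡ 1# →
    ∀ i → shearᴹ (pivotMultipliers A p ι) A i p ≡ 0#
  shearᴹ-clears-pivot A {p} {ι} aₚι≡1 i = begin
    u + - (u * ι) * A zero p   ≡⟨ cong (u +_) (-‿distribˡ-* (u * ι) (A zero p)) ⟨
    u + - (u * ι * A zero p)   ≡⟨ cong (λ s → u + - s) (*-assoc u ι (A zero p)) ⟩
    u + - (u * (ι * A zero p)) ≡⟨ cong (λ s → u + - (u * s)) (trans (*-comm ι (A zero p)) aₚι≡1) ⟩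
    u + - (u * 1#)             ≡⟨ cong (λ s → u + - s) (*-identityʳ u) ⟩
    u + - u                    ≡⟨ -‿inverseʳ u ⟩
    0#                         ∎
    where
    u : Carrier
    u = A (suc i) p

  solvable-unshear-at-pivot : ∀ {r n} (A : Fin (suc r) → Fin n → Carrier) y {p ι} → A zero p * ι ≡ 1# →
    let d = pivotMultipliers A p ι in Solvable (shearᴹ d A) (shear d y) → Solvable A y
  solvable-unshear-at-pivot {r} {n} A y {p} {ι} aₚι≡1 (x , x-solves) =
    x′ , solvable-unshear d A y x′ x′-solves row₀
    where
    d : Vector Carrier r
    d = pivotMultipliers A p ι

    D t : Carrier
    D = A zero ∙ x
    t = (y zero - D) * ι

    -- Column p of the sheared system vanishes, so moving x along unit p only changes row 0.
    x′ : Vector Carrier n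
    x′ = x +ᵛ t ·ᵛ unit p

    x′-solves : shearᴹ d A *ᴹ x′ ≗ shear d y
    x′-solves i = begin
      shearᴹ d A i ∙ x′                     ≡⟨ ∙-shift-unit (shearᴹ d A i) x t p ⟩
      shearᴹ d A i ∙ x + t * shearᴹ d A i p ≡⟨ cong₂ (λ a b → a + t * b) (x-solves i)
                                                      (shearᴹ-clears-pivot A aₚι≡1 i) ⟩
      shear d y i + t * 0#                  ≡⟨ cong (shear d y i +_) (zeroʳ t) ⟩
      shear d y i + 0#                      ≡⟨ +-identityʳ (shear d y i) ⟩
      shear d y i                           ∎

    row₀ : A zero ∙ x′ ≡ y zero
    row₀ = begin
      A zero ∙ x′                       ≡⟨ ∙-shift-unit (A zero) x t p ⟩
      D + (y zero - D) * ι * A zero p   ≡⟨ cong (D +_) (*-assoc (y zero - D) ι (A zero p)) ⟩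
      D + (y zero - D) * (ι * A zero p) ≡⟨ cong (λ s → D + (y zero - D) * s)
                                                (trans (*-comm ι (A zero p)) aₚι≡1) ⟩
      D + (y zero - D) * 1#             ≡⟨ cong (D +_) (*-identityʳ (y zero - D)) ⟩
      D + (y zero - D)                  ≡⟨ +-assoc D (y zero) (- D) ⟨
      D + y zero - D                    ≡⟨ xyx⁻¹≈y D (y zero) ⟩
      y zero                            ∎

  ≡0-decidable : ∀ {q m} (e : Fin q → Carrier) → (∀ i j → e i ≡ e j → i ≡ j) →
    ImageOf L e 0# → HasDegree L (ImageOf L e) m → ∀ x → Dec (x ≡ 0#)
  ≡0-decidable e e-injective (i₀ , eᵢ₀≡0) (b , b-indep , b-spans) x with b-spans x
  ... | a , a∈K , x≗ab with all? (λ i → proj₁ (a∈K i) ≟ i₀)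
  ...   | yes indices≡i₀ = yes (trans (x≗ab zero) (∙-zeroˡ (cols L b zero) a≗0))
    where
    a≗0 : a ≗ 0ᵛ
    a≗0 i = trans (sym (proj₂ (a∈K i))) (trans (cong e (indices≡i₀ i)) eᵢ₀≡0)
  ...   | no indices≢i₀ = no λ x≡0 → indices≢i₀ λ i → e-injective _ _
    (trans (proj₂ (a∈K i)) (trans (b-indep a a∈K (λ j → trans (sym (x≗ab j)) x≡0) i) (sym eᵢ₀≡0)))

  module WithDecidableZero (_≟0 : ∀ x → Dec (x ≡ 0#)) where

    zero-or-pivot : ∀ {n} (v : Vector Carrier n) → v ≗ 0ᵛ ⊎ ∃[ p ] ¬ (v p ≡ 0#)
    zero-or-pivot v with all? (λ j → v j ≟0)
    ... | yes v≗0 = inj₁ v≗0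
    ... | no v≢0  = inj₂ (¬∀⟶∃¬ _ _ (λ j → v j ≟0) v≢0)

    fredholm : ∀ {r n} (A : Fin r → Fin n → Carrier) y → Solvable A y ⊎ Obstructed A y
    fredholm {zero} A y = inj₁ (0ᵛ , λ ())
    fredholm {suc r} A y with zero-or-pivot (A zero) | y zero ≟0
    ... | inj₁ a≗0 | no y₀≢0  = inj₂ (obstructed-by-zero-row A y a≗0 y₀≢0)
    ... | inj₁ a≗0 | yes y₀≡0 =
      Sum.map (solvable-unshear-zero-row 0ᵛ A y a≗0 y₀≡0) (obstructed-unshear 0ᵛ A y)
              (fredholm (shearᴹ 0ᵛ A) (shear 0ᵛ y))
    ... | inj₂ (p , aₚ≢0) | _ with inverse (A zero p) aₚ≢0
    ...   | ι , aₚι≡1 =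
      Sum.map (solvable-unshear-at-pivot A y aₚι≡1) (obstructed-unshear d A y)
              (fredholm (shearᴹ d A) (shear d y))
      where
      d : Vector Carrier r
      d = pivotMultipliers A p ι

    *ᴹ-surjective : ∀ {r n} (A : Fin r → Fin n → Carrier) → IndepOver L (AllL L) A →
      ∀ y → Solvable A y
    *ᴹ-surjective A A-indep y with fredholm A y
    ... | inj₁ solution          = solution
    ... | inj₂ (z , zA≗0 , zy≢0) = contradiction (∙-zeroˡ y (A-indep z (λ _ → tt) zA≗0)) zy≢0

    *ᴹ-quotientIso : ∀ {r n} {S : Vector Carrier n → Set} (A : Fin r → Fin n → Carrier) →
      IndepOver L (AllL L) A → (∀ x → (A *ᴹ x ≗ 0ᵛ) ⇔ S x) → IsQuotientIso L S (A *ᴹ_)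
    *ᴹ-quotientIso A A-indep ker = *ᴹ-isLinear A , *ᴹ-surjective A A-indep , ker

    *ᴹ≗0⇔code : ∀ {r s n} (G : Fin r → Fin n → Carrier) (H : Fin s → Fin n → Carrier) →
      IsGeneratorMatrix L H (Dual L (Code L G)) → ∀ x → (H *ᴹ x ≗ 0ᵛ) ⇔ Code L G x
    *ᴹ≗0⇔code G H (_ , H-spans) x = mk⇔ to from
      where
      to : H *ᴹ x ≗ 0ᵛ → Code L G x
      to Hx≗0 with fredholm (cols L G) x
      ... | inj₁ (a , Gᵀa≗x) = a , (λ _ → tt) , λ j → trans (sym (Gᵀa≗x j)) (∙-comm (cols L G j) a)
      ... | inj₂ (z , Gz≗0 , zx≢0) = contradiction (span-orthogonal H Hx≗0 z∈span) zx≢0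
        where
        z∈C⊥ : Dual L (Code L G) z
        z∈C⊥ = Equivalence.to (*ᴹ≗0⇔dual G z) (λ i → trans (∙-comm (G i) z) (Gz≗0 i))

        z∈span : SpanOver L (AllL L) H z
        z∈span = Equivalence.to (H-spans z) z∈C⊥

      from : Code L G x → H *ᴹ x ≗ 0ᵛ
      from x∈C i = trans (∙-comm (H i) x) (Hᵢ∈C⊥ x x∈C)
        where
        Hᵢ∈C⊥ : Dual L (Code L G) (H i)
        Hᵢ∈C⊥ = Equivalence.from (H-spans (H i)) (row∈span H i)

corollary2p8 : (q m n k : ℕ) → IsPrimePower q → 1 ≤ m → 1 ≤ n → 1 ≤ k →
    (L : Field) →
    (e : Fin q → Field.Carrier L) → (∀ i j → e i ≡ e j → i ≡ j) →
    IsSubfield L (ImageOf L e) → HasDegree L (ImageOf L e) m →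
    (G : Fin k → Fin n → Field.Carrier L) →
    (H : Fin (n ∸ k) → Fin n → Field.Carrier L) →
    IsGeneratorMatrix L G (Code L G) →
    IsGeneratorMatrix L H (Dual L (Code L G)) →
    IndepOver L (ImageOf L e) (cols L G) →
    IndepOver L (ImageOf L e) (cols L H) →
    ∃[ φ ] ∃[ ψ ]
      ( IsQuotientIso L (Dual L (Code L G)) φ
      × ImageEq L (ImageOf L e) (Dual L (Code L G)) φ (SpanOver L (ImageOf L e) (cols L G))
      × IsQuotientIso L (Code L G) ψ
      × ImageEq L (ImageOf L e) (Code L G) ψ (SpanOver L (ImageOf L e) (cols L H)) )
corollary2p8 _ _ _ _ _ _ _ _ L e e-injective K-subfield K-degree G H (G-indep , _) H-generates@(H-indep , _) _ _ =
    G *ᴹ_ , H *ᴹ_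
  , *ᴹ-quotientIso G G-indep ker-G , imageEq-*ᴹ (ImageOf L e) G ker-G
  , *ᴹ-quotientIso H H-indep ker-H , imageEq-*ᴹ (ImageOf L e) H ker-H
  where
  open LinearAlgebra L
  open WithDecidableZero (≡0-decidable e e-injective (IsSubfield.0∈ K-subfield) K-degree)

  ker-G : ∀ x → (G *ᴹ x ≗ 0ᵛ) ⇔ Dual L (Code L G) x
  ker-G = *ᴹ≗0⇔dual G

  ker-H : ∀ x → (H *ᴹ x ≗ 0ᵛ) ⇔ Code L G x
  ker-H = *ᴹ≗0⇔code G H H-generates
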